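{- For every prime $p$ and all natural integers $j,k$ with $j\ge1$, $$\frac{(jk)!}{(j!)^k\,k!}\equiv\frac{(pjk)!}{((pj)!)^k\,k!}\pmod p.$$
   Context: Both sides are integers (they count partitions of a set of $jk$, resp. $pjk$, elements into $k$ unordered blocks of size $j$, resp. $pj$). -}

module Defs where

open import Data.Nat.Base using (ℕ; _*_; _^_; _/_; _!; NonZero)
open import Data.Nat.Properties using (m*n≢0; m^n≢0; _!≢0)

denom≢0 : ∀ j k → NonZero ((j !) ^ k * k !)
denom≢0 j k = m*n≢0 ((j !) ^ k) (k !) {{m^n≢0 (j !) k {{j !≢0}}}} {{k !≢0}}

-- (jk)! / ((j!)^k k!)  (exact truncated division; the quotient is an integer)
multinomialQuot : ℕ → ℕ → ℕ
multinomialQuot j k = ((j * k) !) / ((j !) ^ k * k !) where instance _ = denom≢0 j k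

module Submission where

-- Write  Q(j,k) = (jk)! / ((j!)^k k!)  for the number of partitions of a
-- jk-element set into k unordered blocks of size j.  The proof has three parts.
--
-- 1. Product formula.  Removing the block that contains a fixed element gives
--      Q(i+1, k+1) = C((i+1)k + i, i) · Q(i+1, k),
--    so Q(i+1, k) is the product  blockPartitions i k  of these binomials; we
--    verify  blockPartitions i k · ((i+1)!)^k · k! = ((i+1)k)!  and divide.
-- 2. Lucas' congruence.  For a prime p and digits r, s < p,
--      C(pa + r, pb + s) ≡ C(a, b) · C(r, s)  (mod p),
--    proved by induction on the upper index via Pascal's rule, using that p
--    divides C(p, t) for 0 < t < p.
-- 3. With j = i+1 the factors of Q(pj, k) are C(p((i+1)m + i) + (p-1), pi + (p-1)),
--    which Lucas reduces mod p to C((i+1)m + i, i) · C(p-1, p-1), i.e. to the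
--    factors of Q(j, k).

open import Defs
open import Data.Nat.Base
open import Data.Nat.Properties
open import Data.Nat.DivMod using (%-distribˡ-+; %-distribˡ-*; m*n%n≡0; m*n/n≡m; m/n*n≡m)
open import Data.Nat.Divisibility using (_∣_; divides; ∣⇒≤; ∣1⇒≡1; m∣m*n)
open import Data.Nat.Combinatorics
  using (_C_; nCk≡n!/k![n-k]!; k![n∸k]!∣n!; nCk+nC[k+1]≡[n+1]C[k+1]; nCn≡1; k>n⇒nCk≡0)
open import Data.Nat.Primality using (Prime; prime⇒nonZero; euclidsLemma; ¬prime[0]; ¬prime[1])
open import Data.Nat.Tactic.RingSolver using (solve-∀)
open import Data.Sum using (inj₁; inj₂)
open import Data.Empty using (⊥-elim)
open import Relation.Nullary using (¬_)
open import Relation.Binary.Bundles using (Setoid)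
open import Relation.Binary.Structures using (IsEquivalence)
open import Relation.Binary.PropositionalEquality
  using (_≡_; refl; sym; trans; cong; cong₂; subst; module ≡-Reasoning)
import Relation.Binary.Reasoning.Setoid as SetoidReasoning

binomial-factorial : ∀ {n k} → k ≤ n → (n C k) * (k ! * (n ∸ k) !) ≡ n !
binomial-factorial {n} {k} k≤n =
  trans (cong (_* (k ! * (n ∸ k) !)) (nCk≡n!/k![n-k]! k≤n)) (m/n*n≡m (k![n∸k]!∣n! k≤n))
  where instance _ = k !* (n ∸ k) !≢0

binomial-factorial-+ : ∀ n i → ((n + i) C i) * (i ! * n !) ≡ (n + i) !
binomial-factorial-+ n i = begin
  ((n + i) C i) * (i ! * n !)             ≡⟨ cong (λ m → ((n + i) C i) * (i ! * m !)) (sym (m+n∸n≡m n i)) ⟩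
  ((n + i) C i) * (i ! * (n + i ∸ i) !)   ≡⟨ binomial-factorial (m≤n+m i n) ⟩
  (n + i) !                               ∎
  where open ≡-Reasoning

-- blockPartitions i k counts partitions of a set of (i+1)k elements into k
-- unordered blocks of size i+1: the block of a fixed element is chosen in
-- C((i+1)(k-1) + i, i) ways and the rest is partitioned recursively.
blockPartitions : ℕ → ℕ → ℕ
blockPartitions i zero    = 1
blockPartitions i (suc k) = ((suc i * k + i) C i) * blockPartitions i k

regroup : ∀ i k c B I F K →
          (c * B) * ((suc i * I) * F * (suc k * K)) ≡ (suc i * suc k) * (c * (I * (B * (F * K))))
regroup = solve-∀

blockPartitions-factorial : ∀ i k → blockPartitions i k * ((suc i !) ^ k * k !) ≡ (suc i * k) !
blockPartitions-factorial i zero = cong _! (sym (*-zeroʳ (suc i)))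
blockPartitions-factorial i (suc k) = begin
  blockPartitions i (suc k) * ((suc i !) ^ suc k * suc k !)
    ≡⟨ regroup i k c (blockPartitions i k) (i !) ((suc i !) ^ k) (k !) ⟩
  (suc i * suc k) * (c * (i ! * (blockPartitions i k * ((suc i !) ^ k * k !))))
    ≡⟨ cong (λ x → (suc i * suc k) * (c * (i ! * x))) (blockPartitions-factorial i k) ⟩
  (suc i * suc k) * (c * (i ! * (suc i * k) !))
    ≡⟨ cong ((suc i * suc k) *_) (binomial-factorial-+ (suc i * k) i) ⟩
  (suc i * suc k) * (suc i * k + i) !
    ≡⟨ cong (_* (suc i * k + i) !) size ⟩
  (suc (suc i * k + i)) !
    ≡⟨ cong _! size ⟨
  (suc i * suc k) !
    ∎
  where
  open ≡-Reasoning
  c = (suc i * k + i) C i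
  size : suc i * suc k ≡ suc (suc i * k + i)
  size = trans (*-suc (suc i) k) (cong suc (+-comm i (suc i * k)))

multinomialQuot≡blockPartitions : ∀ i k → multinomialQuot (suc i) k ≡ blockPartitions i k
multinomialQuot≡blockPartitions i k = begin
  (suc i * k) ! / D                 ≡⟨ cong (_/ D) (blockPartitions-factorial i k) ⟨
  blockPartitions i k * D / D       ≡⟨ m*n/n≡m (blockPartitions i k) D ⟩
  blockPartitions i k               ∎
  where
  open ≡-Reasoning
  D = (suc i !) ^ k * k !
  instance _ = denom≢0 (suc i) k

-- Base-(q+1) predecessor: the number with digits (a+1, 0) is one more than (a, q).
carry : ∀ q a → suc q * suc a + 0 ≡ suc (suc q * a + q)
carry q a = begin
  suc q * suc a + 0      ≡⟨ +-identityʳ (suc q * suc a) ⟩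
  suc q * suc a          ≡⟨ *-suc (suc q) a ⟩
  suc q + suc q * a      ≡⟨ +-comm (suc q) (suc q * a) ⟩
  suc q * a + suc q      ≡⟨ +-suc (suc q * a) q ⟩
  suc (suc q * a + q)    ∎
  where open ≡-Reasoning

-- The upper index of the m-th factor for block size p(i+1) is p times the one
-- for block size i+1, plus the top digit p-1  (here p = q+1).
scaled-upper-index : ∀ q i m → suc (suc q * i + q) * m + (suc q * i + q) ≡ suc q * (suc i * m + i) + q
scaled-upper-index = solve-∀

-- Congruence modulo a nonzero modulus p, as a setoid compatible with + and *.
-- (A record, so that both sides can be inferred from the type.)
module Congruence (p : ℕ) .{{_ : NonZero p}} where

  infix 4 _≈_
  record _≈_ (x y : ℕ) : Set where
    constructor mod-eq
    field same-remainder : x % p ≡ y % p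
  open _≈_ public

  ≈-isEquivalence : IsEquivalence _≈_
  ≈-isEquivalence = record
    { refl  = mod-eq refl
    ; sym   = λ e → mod-eq (sym (same-remainder e))
    ; trans = λ e f → mod-eq (trans (same-remainder e) (same-remainder f))
    }

  ≈-setoid : Setoid _ _
  ≈-setoid = record { isEquivalence = ≈-isEquivalence }

  open IsEquivalence ≈-isEquivalence public using () renaming (refl to ≈-refl; sym to ≈-sym)

  ≡⇒≈ : ∀ {x y} → x ≡ y → x ≈ y
  ≡⇒≈ refl = ≈-refl

  ≈-+ : ∀ {a a' b b'} → a ≈ a' → b ≈ b' → a + b ≈ a' + b'
  ≈-+ {a} {a'} {b} {b'} (mod-eq e) (mod-eq f) = mod-eq
    (trans (%-distribˡ-+ a b p) (trans (cong₂ (λ x y → (x + y) % p) e f) (sym (%-distribˡ-+ a' b' p))))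

  ≈-* : ∀ {a a' b b'} → a ≈ a' → b ≈ b' → a * b ≈ a' * b'
  ≈-* {a} {a'} {b} {b'} (mod-eq e) (mod-eq f) = mod-eq
    (trans (%-distribˡ-* a b p) (trans (cong₂ (λ x y → (x * y) % p) e f) (sym (%-distribˡ-* a' b' p))))

  ∣⇒≈0 : ∀ {n} → p ∣ n → n ≈ 0
  ∣⇒≈0 (divides q refl) = mod-eq (trans (m*n%n≡0 q p) (sym (m*n%n≡0 0 p)))

module ModPrime (p' : ℕ) (prime : Prime (suc p')) where

  p : ℕ
  p = suc p'

  open Congruence p public
  open SetoidReasoning ≈-setoid

  -- A prime does not divide m! when m < p (every factor is smaller than p).
  prime∤m! : ∀ {m} → m < p → ¬ (p ∣ m !)
  prime∤m! {zero}  _   p∣1 = ¬prime[1] (subst Prime (∣1⇒≡1 p∣1) prime)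
  prime∤m! {suc m} m<p p∣m! with euclidsLemma (suc m) (m !) prime p∣m!
  ... | inj₁ p∣1+m = <⇒≱ m<p (∣⇒≤ p∣1+m)
  ... | inj₂ p∣m!' = prime∤m! (<-trans (n<1+n m) m<p) p∣m!'

  -- p divides C(p, t) for 0 < t < p:  p ∣ p! = C(p,t) · t! · (p-t)!  and p ∤ t!, (p-t)!.
  p∣pCt : ∀ {t} → 0 < t → t < p → p ∣ p C t
  p∣pCt {t} 0<t t<p
    with euclidsLemma (p C t) (t ! * (p ∸ t) !) prime
           (subst (p ∣_) (sym (binomial-factorial (<⇒≤ t<p))) (m∣m*n (p' !)))
  ... | inj₁ p∣pCt = p∣pCt
  ... | inj₂ p∣t![p-t]! with euclidsLemma (t !) ((p ∸ t) !) prime p∣t![p-t]!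
  ...   | inj₁ p∣t!     = ⊥-elim (prime∤m! t<p p∣t!)
  ...   | inj₂ p∣[p-t]! = ⊥-elim (prime∤m! (∸-monoʳ-< 0<t (<⇒≤ t<p)) p∣[p-t]!)

  zero-digits : p * 0 + 0 ≡ 0
  zero-digits = trans (+-identityʳ (p * 0)) (*-zeroʳ p)

  pascal-step : ∀ {n n' m m' x y} → n ≡ suc n' → m ≡ suc m' →
                n' C m' ≈ x → n' C m ≈ y → n C m ≈ x + y
  pascal-step {n' = n'} {m' = m'} refl refl e f = begin
    suc n' C suc m'          ≡⟨ nCk+nC[k+1]≡[n+1]C[k+1] n' m' ⟨
    n' C m' + n' C suc m'    ≈⟨ ≈-+ e f ⟩
    _                        ∎

  lucas : ∀ a r b s → r < p → s < p → (p * a + r) C (p * b + s) ≈ (a C b) * (r C s)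
  lucas a r zero zero _ _ = ≡⇒≈ (cong ((p * a + r) C_) zero-digits)
  lucas zero zero (suc b) s _ _ = ≡⇒≈ (cong (_C (p * suc b + s)) zero-digits)
  lucas zero zero zero (suc s) _ _ = ≡⇒≈ (cong₂ _C_ zero-digits (cong (_+ suc s) (*-zeroʳ p)))
  lucas a (suc r) b (suc s) r<p s<p = begin
    (p * a + suc r) C (p * b + suc s)
      ≈⟨ pascal-step (+-suc (p * a) r) (+-suc (p * b) s)
           (lucas a r b s r'<p s'<p) (lucas a r b (suc s) r'<p s<p) ⟩
    (a C b) * (r C s) + (a C b) * (r C suc s)   ≡⟨ *-distribˡ-+ (a C b) (r C s) (r C suc s) ⟨
    (a C b) * (r C s + r C suc s)               ≡⟨ cong ((a C b) *_) (nCk+nC[k+1]≡[n+1]C[k+1] r s) ⟩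
    (a C b) * (suc r C suc s)                   ∎
    where r'<p = <-trans (n<1+n r) r<p
          s'<p = <-trans (n<1+n s) s<p
  lucas a (suc r) (suc b) zero r<p _ = begin
    (p * a + suc r) C (p * suc b + 0)
      ≈⟨ pascal-step (+-suc (p * a) r) (carry p' b)
           (lucas a r b p' r'<p ≤-refl) (lucas a r (suc b) 0 r'<p z<s) ⟩
    (a C b) * (r C p') + (a C suc b) * 1   ≡⟨ cong (λ c → (a C b) * c + (a C suc b) * 1) (k>n⇒nCk≡0 (≤-pred r<p)) ⟩
    (a C b) * 0 + (a C suc b) * 1          ≡⟨ cong (_+ (a C suc b) * 1) (*-zeroʳ (a C b)) ⟩
    (a C suc b) * (suc r C 0)              ∎
    where r'<p = <-trans (n<1+n r) r<p
  lucas (suc a) zero b (suc s) _ s<p = begin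
    (p * suc a + 0) C (p * b + suc s)
      ≈⟨ pascal-step (carry p' a) (+-suc (p * b) s)
           (lucas a p' b s ≤-refl (<-trans (n<1+n s) s<p)) (lucas a p' b (suc s) ≤-refl s<p) ⟩
    (a C b) * (p' C s) + (a C b) * (p' C suc s)   ≡⟨ *-distribˡ-+ (a C b) (p' C s) (p' C suc s) ⟨
    (a C b) * (p' C s + p' C suc s)               ≡⟨ cong ((a C b) *_) (nCk+nC[k+1]≡[n+1]C[k+1] p' s) ⟩
    (a C b) * (p C suc s)                         ≈⟨ ≈-* (≈-refl {a C b}) (∣⇒≈0 (p∣pCt z<s s<p)) ⟩
    (a C b) * 0                                   ≡⟨ *-zeroʳ (a C b) ⟩
    0                                             ≡⟨ *-zeroʳ (suc a C b) ⟨
    (suc a C b) * (0 C suc s)                     ∎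
  lucas (suc a) zero (suc b) zero _ _ = begin
    (p * suc a + 0) C (p * suc b + 0)
      ≈⟨ pascal-step (carry p' a) (carry p' b) (lucas a p' b p' ≤-refl ≤-refl) (lucas a p' (suc b) 0 ≤-refl z<s) ⟩
    (a C b) * (p' C p') + (a C suc b) * 1   ≡⟨ cong₂ _+_ (trans (cong ((a C b) *_) (nCn≡1 p')) (*-identityʳ (a C b)))
                                                          (*-identityʳ (a C suc b)) ⟩
    a C b + a C suc b                       ≡⟨ nCk+nC[k+1]≡[n+1]C[k+1] a b ⟩
    suc a C suc b                           ≡⟨ *-identityʳ (suc a C suc b) ⟨
    (suc a C suc b) * (0 C 0)               ∎

  factor-mod : ∀ i m → (suc i * m + i) C i ≈ (suc (p * i + p') * m + (p * i + p')) C (p * i + p')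
  factor-mod i m = begin
    X                                   ≡⟨ *-identityʳ X ⟨
    X * 1                               ≡⟨ cong (X *_) (nCn≡1 p') ⟨
    X * (p' C p')                       ≈⟨ ≈-sym (lucas (suc i * m + i) p' i p' ≤-refl ≤-refl) ⟩
    (p * (suc i * m + i) + p') C (p * i + p')
      ≡⟨ cong (_C (p * i + p')) (scaled-upper-index p' i m) ⟨
    (suc (p * i + p') * m + (p * i + p')) C (p * i + p')  ∎
    where X = (suc i * m + i) C i

  blockPartitions-mod : ∀ i k → blockPartitions i k ≈ blockPartitions (p * i + p') k
  blockPartitions-mod i zero    = ≈-refl
  blockPartitions-mod i (suc k) = ≈-* (factor-mod i k) (blockPartitions-mod i k)

proposition7p4 : (p : ℕ) → (pp : Prime p) → (j k : ℕ) → j ≥ 1 →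
    _%_ (multinomialQuot j k) p {{prime⇒nonZero pp}}
      ≡ _%_ (multinomialQuot (p * j) k) p {{prime⇒nonZero pp}}
proposition7p4 zero     pp _       _ _ = ⊥-elim (¬prime[0] pp)
proposition7p4 (suc p') pp zero    _ ()
proposition7p4 (suc p') pp (suc i) k _ = same-remainder (begin
  multinomialQuot (suc i) k               ≡⟨ multinomialQuot≡blockPartitions i k ⟩
  blockPartitions i k                     ≈⟨ blockPartitions-mod i k ⟩
  blockPartitions (p * i + p') k          ≡⟨ multinomialQuot≡blockPartitions (p * i + p') k ⟨
  multinomialQuot (suc (p * i + p')) k    ≡⟨ cong (λ j → multinomialQuot j k) p[1+i]≡1+pi+p' ⟨
  multinomialQuot (p * suc i) k           ∎)
  where
  open ModPrime p' pp
  open SetoidReasoning ≈-setoid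
  p[1+i]≡1+pi+p' : p * suc i ≡ suc (p * i + p')
  p[1+i]≡1+pi+p' = trans (sym (+-identityʳ (p * suc i))) (carry p' i)
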